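{- Let $k,m\geqslant1$ and $l\geqslant0$ be integers, and let ${\tt w}$ be the one-sided fixed point (starting with ${\tt a}$) of the substitution $\sigma_{k,l,m}:{\tt a}\mapsto{\tt a}^k{\tt b}{\tt a}^l,\ {\tt b}\mapsto{\tt a}^m$. Then for all $n\geqslant1$, \[p_{\tt b}(n)=m\, p_{\tt a}(n)+(k+l+1-m)n+m-l-1,\] and in particular \[r(n)=(m-1)\,p_{\tt a}(n)+(k+l+1-m)n+m-l-1.\] Moreover, ${\tt w}$ is the unique word ${\tt w}'\in\mathcal{W}$ whose position and relative position functions satisfy $r_{{\tt w}'}(n)=(m-1)\,p_{{\tt a},{\tt w}'}(n)+(k+l+1-m)n+m-l-1$ for all $n\geqslant1$.
   Context: Words are infinite one-sided words over $\{{\tt a},{\tt b}\}$ indexed from position $0$; $\mathcal{W}$ is the set of such words in which both letters occur infinitely often. For ${\tt w}\in\mathcal{W}$ and $n\geqslant1$, $p_{\tt a}(n)=p_{{\tt a},{\tt w}}(n)$ (resp. $p_{\tt b}(n)$) is the position of the $n$-th occurrence of ${\tt a}$ (resp. ${\tt b}$) in ${\tt w}$, and $r(n)=r_{\tt w}(n)=p_{\tt b}(n)-p_{\tt a}(n)$. Here ${\tt a}^k$ denotes $k$ consecutive copies of ${\tt a}$. -}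

module Defs where

open import Data.Nat using (ℕ; zero; suc; _+_; _≤_)
open import Data.List using (List; []; _∷_; _++_; concatMap; replicate)
open import Data.Product using (Σ; _×_; ∃-syntax)
open import Relation.Binary.PropositionalEquality using (_≡_)
open import Data.Integer as ℤ using (ℤ; +_)

data Letter : Set where
  𝕒 𝕓 : Letter

-- Infinite one-sided words, indexed from position 0.
Word : Set
Word = ℕ → Letter

ind : Letter → Letter → ℕ
ind 𝕒 𝕒 = 1
ind 𝕓 𝕓 = 1
ind _ _ = 0

cnt : Word → Letter → ℕ → ℕ
cnt w x zero    = 0
cnt w x (suc p) = cnt w x p + ind x (w p)

InfOften : Word → Letter → Set
InfOften w x = ∀ N → ∃[ j ] (N ≤ j × w j ≡ x)

In𝒲 : Word → Set
In𝒲 w = InfOften w 𝕒 × InfOften w 𝕓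

-- NthOcc w x n p : position p is the n-th occurrence (n ≥ 1) of x in w,
-- i.e. p_{x,w}(n) = p.
NthOcc : Word → Letter → ℕ → ℕ → Set
NthOcc w x n p = (w p ≡ x) × (suc (cnt w x p) ≡ n)

σ : ℕ → ℕ → ℕ → Letter → List Letter
σ k l m 𝕒 = replicate k 𝕒 ++ (𝕓 ∷ replicate l 𝕒)
σ k l m 𝕓 = replicate m 𝕒

iter : ℕ → ℕ → ℕ → ℕ → List Letter
iter k l m zero    = 𝕒 ∷ []
iter k l m (suc n) = concatMap (σ k l m) (iter k l m n)

-- i-th letter of a list, with default 𝕒 if out of range.
nth : List Letter → ℕ → Letter
nth []       i       = 𝕒
nth (x ∷ xs) zero    = x
nth (x ∷ xs) (suc i) = nth xs i

-- The one-sided fixed point of σ_{k,l,m} starting with a (for k ≥ 1):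
-- the limit of the prefixes σ^n(a); σ^(i+1)(a) has length > i, so its
-- i-th letter is the i-th letter of the fixed point.
fixpt : ℕ → ℕ → ℕ → Word
fixpt k l m i = nth (iter k l m (suc i)) i

rhsR : ℕ → ℕ → ℕ → ℕ → ℕ → ℤ
rhsR k l m p n =
  ((+ m) ℤ.- (+ 1)) ℤ.* (+ p) ℤ.+ ((+ (k + l + 1)) ℤ.- (+ m)) ℤ.* (+ n)
    ℤ.+ (+ m) ℤ.- (+ l) ℤ.- (+ 1)

rhsB : ℕ → ℕ → ℕ → ℕ → ℕ → ℤ
rhsB k l m p n =
  (+ m) ℤ.* (+ p) ℤ.+ ((+ (k + l + 1)) ℤ.- (+ m)) ℤ.* (+ n)
    ℤ.+ (+ m) ℤ.- (+ l) ℤ.- (+ 1)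

{-# OPTIONS --safe #-}
module Submission where

-- σ(a) contains a single b, at offset k, and σ(b) contains none.  Hence in the
-- fixed point w = σ(w) the n-th b is the b of σ(w pa), where pa is the position
-- of the n-th a; it sits at |σ(w 0 ⋯ w (pa-1))| + k = (k+l+1)(n-1) + m(pa-n+1) + k,
-- because n-1 letters a and pa-n+1 letters b precede pa.  Conversely, the law
-- expresses the position of the n-th b through the prefix before the n-th a,
-- which lies strictly earlier; so by induction on i any word of 𝒲 obeying it has
-- a b at position i exactly when w has.

open import Defs
open import Data.Nat using (ℕ; zero; suc; _+_; _*_; _≤_; _<_; z≤n; s≤s; s≤s⁻¹)
open import Data.Nat.Properties
open import Data.Nat.Induction using (<-rec)
import Data.Nat.Tactic.RingSolver as ℕ-Ring
open import Data.Integer as ℤ using (+_)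
import Data.Integer.Properties as ℤP
import Data.Integer.Tactic.RingSolver as ℤ-Ring
open import Algebra.Properties.AbelianGroup ℤP.+-0-abelianGroup using (∙-cancelʳ)
open import Data.List using (List; []; _∷_; _++_; concatMap; replicate; length; map)
open import Data.List.Properties using (length-++; length-replicate; map-++; concatMap-++)
open import Data.Nat.ListAction using (sum)
open import Data.Nat.ListAction.Properties using (sum-++)
open import Data.Product using (∃-syntax; _×_; _,_; proj₁; proj₂)
open import Data.Sum using (inj₁; inj₂)
open import Data.Empty using (⊥-elim)
open import Function using (_∘_)
open import Relation.Nullary using (yes; no)
open import Relation.Binary.Definitions using (tri<; tri≈; tri>)
open import Relation.Binary.PropositionalEquality
  using (_≡_; _≢_; refl; sym; trans; cong; cong₂; subst; module ≡-Reasoning)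

private
  variable
    w w′ : Word
    x x′ : Letter
    c i j n p q pa pb : ℕ

𝕒≢𝕓 : 𝕒 ≢ 𝕓
𝕒≢𝕓 ()

ind-self : ∀ x → ind x x ≡ 1
ind-self 𝕒 = refl
ind-self 𝕓 = refl

ind𝕒+ind𝕓≡1 : ∀ y → ind 𝕒 y + ind 𝕓 y ≡ 1
ind𝕒+ind𝕓≡1 𝕒 = refl
ind𝕒+ind𝕓≡1 𝕓 = refl

AgreeBelow : ℕ → Word → Word → Set
AgreeBelow p w w′ = ∀ {q} → q < p → w q ≡ w′ q

AgreeBelow-sym : AgreeBelow p w w′ → AgreeBelow p w′ w
AgreeBelow-sym agree q<p = sym (agree q<p)

AgreeBelow-mono : q ≤ p → AgreeBelow p w w′ → AgreeBelow q w w′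
AgreeBelow-mono q≤p agree r<q = agree (<-≤-trans r<q q≤p)

-- Counting occurrences

cnt-suc-occ : ∀ w p → w p ≡ x → cnt w x (suc p) ≡ suc (cnt w x p)
cnt-suc-occ {x} w p refl = trans (cong (_+_ (cnt w x p)) (ind-self x)) (+-comm _ 1)

cnt-mono : ∀ w x → p ≤ q → cnt w x p ≤ cnt w x q
cnt-mono {q = zero}  w x z≤n = ≤-refl
cnt-mono {q = suc q} w x p≤1+q with m≤n⇒m<n∨m≡n p≤1+q
... | inj₁ p<1+q = ≤-trans (cnt-mono w x (s≤s⁻¹ p<1+q)) (m≤m+n _ _)
... | inj₂ refl  = ≤-refl

cnt-cong : AgreeBelow p w w′ → cnt w x p ≡ cnt w′ x p
cnt-cong {zero}  agree = refl
cnt-cong {suc p} {x = x} agree =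
  cong₂ _+_ (cnt-cong (AgreeBelow-mono (n≤1+n p) agree)) (cong (ind x) (agree ≤-refl))

cnt𝕒+cnt𝕓 : ∀ w p → cnt w 𝕒 p + cnt w 𝕓 p ≡ p
cnt𝕒+cnt𝕓 w zero    = refl
cnt𝕒+cnt𝕓 w (suc p) = begin
  (cnt w 𝕒 p + ind 𝕒 (w p)) + (cnt w 𝕓 p + ind 𝕓 (w p)) ≡⟨ interchange (cnt w 𝕒 p) (cnt w 𝕓 p) (ind 𝕒 (w p)) (ind 𝕓 (w p)) ⟩
  (cnt w 𝕒 p + cnt w 𝕓 p) + (ind 𝕒 (w p) + ind 𝕓 (w p)) ≡⟨ cong₂ _+_ (cnt𝕒+cnt𝕓 w p) (ind𝕒+ind𝕓≡1 (w p)) ⟩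
  p + 1                                                   ≡⟨ +-comm p 1 ⟩
  suc p                                                   ∎
  where
  open ≡-Reasoning
  interchange : ∀ a b c d → (a + c) + (b + d) ≡ (a + b) + (c + d)
  interchange = ℕ-Ring.solve-∀

cnt-after-occ : ∀ w → w p ≡ x → p < q → cnt w x p < cnt w x q
cnt-after-occ {p} {x} {q} w wp≡x p<q = subst (_≤ cnt w x q) (cnt-suc-occ w p wp≡x) (cnt-mono w x p<q)

NthOcc-functional : NthOcc w x n p → NthOcc w x n q → p ≡ q
NthOcc-functional {w} {p = p} {q = q} (wp≡x , #p) (wq≡x , #q) with <-cmp p q
... | tri< p<q _ _ = ⊥-elim (<⇒≢ (cnt-after-occ w wp≡x p<q) (suc-injective (trans #p (sym #q))))
... | tri≈ _ p≡q _ = p≡q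
... | tri> _ _ q<p = ⊥-elim (<⇒≢ (cnt-after-occ w wq≡x q<p) (suc-injective (trans #q (sym #p))))

cnt-unbounded : InfOften w x → ∀ N → ∃[ q ] N ≤ cnt w x q
cnt-unbounded often zero    = 0 , z≤n
cnt-unbounded {w} {x} often (suc N) with cnt-unbounded often N
... | q , N≤cnt with often q
... | j , q≤j , wj≡x =
  suc j , subst (suc N ≤_) (sym (cnt-suc-occ w j wj≡x)) (s≤s (≤-trans N≤cnt (cnt-mono w x q≤j)))

-- cnt grows by at most one per step, so it takes every value below cnt w x q.
NthOcc-below : ∀ q → suc n ≤ cnt w x q → ∃[ p ] NthOcc w x (suc n) p
NthOcc-below {n} {w} {x} (suc q) n<cnt with suc n ≤? cnt w x q
... | yes n<cnt′ = NthOcc-below q n<cnt′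
... | no  n≮cnt′ = q , crossing x (w q) n<cnt (≮⇒≥ n≮cnt′)
  where
  crossing : ∀ x y → suc n ≤ c + ind x y → c ≤ n → y ≡ x × suc c ≡ suc n
  crossing {c} 𝕒 𝕒 n<c+1 c≤n = refl , cong suc (≤-antisym c≤n (s≤s⁻¹ (subst (suc n ≤_) (+-comm c 1) n<c+1)))
  crossing {c} 𝕓 𝕓 n<c+1 c≤n = refl , cong suc (≤-antisym c≤n (s≤s⁻¹ (subst (suc n ≤_) (+-comm c 1) n<c+1)))
  crossing {c} 𝕒 𝕓 n<c+0 c≤n = ⊥-elim (<⇒≱ (subst (suc n ≤_) (+-identityʳ c) n<c+0) c≤n)
  crossing {c} 𝕓 𝕒 n<c+0 c≤n = ⊥-elim (<⇒≱ (subst (suc n ≤_) (+-identityʳ c) n<c+0) c≤n)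

InfOften⇒NthOcc : InfOften w x → ∀ n → ∃[ p ] NthOcc w x (suc n) p
InfOften⇒NthOcc often n with cnt-unbounded often (suc n)
... | q , n<cnt = NthOcc-below q n<cnt

-- Words determined by the position of their n-th b

PrefixDetermined : (Word → ℕ → ℕ) → Set
PrefixDetermined F = ∀ {w w′ p} → AgreeBelow p w w′ → F w p ≡ F w′ p

BPositionLaw : (Word → ℕ → ℕ) → Word → Set
BPositionLaw F w = ∀ n pa pb → NthOcc w 𝕒 n pa → NthOcc w 𝕓 n pb → pb ≡ F w pa

module _ {F : Word → ℕ → ℕ} (F-prefix : PrefixDetermined F) (F-ahead : ∀ w p → p < F w p) where

  -- If w i is the n-th b then the n-th a of w lies before i, hence is also
  -- the n-th a of w′, and the law places the n-th b of w′ at i as well.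
  BPositionLaw-transfers-𝕓 : InfOften w 𝕒 → InfOften w′ 𝕓 → BPositionLaw F w → BPositionLaw F w′ →
    AgreeBelow i w w′ → w i ≡ 𝕓 → w′ i ≡ 𝕓
  BPositionLaw-transfers-𝕓 {w} {w′} {i} 𝕒-often 𝕓-often law law′ agree wi≡𝕓
    with InfOften⇒NthOcc 𝕒-often (cnt w 𝕓 i)
  ... | pa , a-occ@(wpa≡𝕒 , #pa) with InfOften⇒NthOcc 𝕓-often (cnt w 𝕓 i)
  ... | pb′ , b-occ′ = subst (λ r → w′ r ≡ 𝕓) pb′≡i (proj₁ b-occ′)
    where
    i≡F : i ≡ F w pa
    i≡F = law _ pa i a-occ (wi≡𝕓 , refl)
    pa<i : pa < i
    pa<i = subst (pa <_) (sym i≡F) (F-ahead w pa)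
    agree-pa : AgreeBelow pa w w′
    agree-pa = AgreeBelow-mono (<⇒≤ pa<i) agree
    a-occ′ : NthOcc w′ 𝕒 (suc (cnt w 𝕓 i)) pa
    a-occ′ = trans (sym (agree pa<i)) wpa≡𝕒 , trans (cong suc (cnt-cong (AgreeBelow-sym agree-pa))) #pa
    pb′≡i : pb′ ≡ i
    pb′≡i = trans (law′ _ pa pb′ a-occ′ b-occ′) (trans (F-prefix (AgreeBelow-sym agree-pa)) (sym i≡F))

  BPositionLaw-unique : In𝒲 w → In𝒲 w′ → BPositionLaw F w → BPositionLaw F w′ → ∀ i → w′ i ≡ w i
  BPositionLaw-unique {w} {w′} w∈𝒲 w′∈𝒲 law law′ = <-rec (λ i → w′ i ≡ w i) agreeAt
    where
    agreeAt : ∀ i → AgreeBelow i w′ w → w′ i ≡ w i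
    agreeAt i agree with w′ i in w′i≡ | w i in wi≡
    ... | 𝕒 | 𝕒 = refl
    ... | 𝕓 | 𝕓 = refl
    ... | 𝕒 | 𝕓 = ⊥-elim (𝕒≢𝕓 (trans (sym w′i≡)
      (BPositionLaw-transfers-𝕓 (proj₁ w∈𝒲) (proj₂ w′∈𝒲) law law′ (AgreeBelow-sym agree) wi≡)))
    ... | 𝕓 | 𝕒 = ⊥-elim (𝕒≢𝕓 (trans (sym wi≡)
      (BPositionLaw-transfers-𝕓 (proj₁ w′∈𝒲) (proj₂ w∈𝒲) law′ law agree w′i≡)))

-- Finite words

nth-++ˡ : ∀ xs ys i → i < length xs → nth (xs ++ ys) i ≡ nth xs i
nth-++ˡ (x ∷ xs) ys zero    _   = refl
nth-++ˡ (x ∷ xs) ys (suc i) i<n = nth-++ˡ xs ys i (s≤s⁻¹ i<n)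

nth-++ʳ : ∀ xs ys i → nth (xs ++ ys) (length xs + i) ≡ nth ys i
nth-++ʳ []       ys i = refl
nth-++ʳ (x ∷ xs) ys i = nth-++ʳ xs ys i

nth-replicate : ∀ n i → i < n → nth (replicate n x) i ≡ x
nth-replicate (suc n) zero    _   = refl
nth-replicate (suc n) (suc i) i<n = nth-replicate n i (s≤s⁻¹ i<n)

cntList : Letter → List Letter → ℕ
cntList x = sum ∘ map (ind x)

cntList-++ : ∀ x xs ys → cntList x (xs ++ ys) ≡ cntList x xs + cntList x ys
cntList-++ x xs ys = trans (cong sum (map-++ (ind x) xs ys)) (sum-++ (map (ind x) xs) _)

cntList-𝕓-replicate-𝕒 : ∀ n → cntList 𝕓 (replicate n 𝕒) ≡ 0
cntList-𝕓-replicate-𝕒 zero    = refl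
cntList-𝕓-replicate-𝕒 (suc n) = cntList-𝕓-replicate-𝕒 n

cnt-block : ∀ w x s ys → (∀ {j} → j < length ys → w (s + j) ≡ nth ys j) →
  cnt w x (s + length ys) ≡ cnt w x s + cntList x ys
cnt-block w x s []       _     = trans (cong (cnt w x) (+-identityʳ s)) (sym (+-identityʳ _))
cnt-block w x s (y ∷ ys) block = begin
  cnt w x (s + suc (length ys))             ≡⟨ cong (cnt w x) (+-suc s (length ys)) ⟩
  cnt w x (suc s + length ys)               ≡⟨ cnt-block w x (suc s) ys block-tail ⟩
  cnt w x (suc s) + cntList x ys            ≡⟨ cong (λ z → cnt w x s + ind x z + cntList x ys) w[s]≡y ⟩
  cnt w x s + ind x y + cntList x ys        ≡⟨ +-assoc (cnt w x s) _ _ ⟩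
  cnt w x s + cntList x (y ∷ ys)            ∎
  where
  open ≡-Reasoning
  w[s]≡y : w s ≡ y
  w[s]≡y = trans (cong w (sym (+-identityʳ s))) (block (s≤s z≤n))
  block-tail : ∀ {j} → j < length ys → w (suc s + j) ≡ nth ys j
  block-tail {j} j<n = trans (cong w (sym (+-suc s j))) (block (s≤s j<n))

nth-replicate-++ : ∀ n ys → nth (replicate n x ++ ys) n ≡ nth ys 0
nth-replicate-++ zero    ys = refl
nth-replicate-++ (suc n) ys = nth-replicate-++ n ys

cnt𝕓-𝕒-block : ∀ w s d → (∀ {j} → j < d → w (s + j) ≡ 𝕒) → cnt w 𝕓 (s + d) ≡ cnt w 𝕓 s
cnt𝕓-𝕒-block w s d 𝕒s = begin
  cnt w 𝕓 (s + d)                         ≡⟨ cong (λ r → cnt w 𝕓 (s + r)) (sym (length-replicate d)) ⟩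
  cnt w 𝕓 (s + length (replicate d 𝕒))    ≡⟨ cnt-block w 𝕓 s (replicate d 𝕒) block ⟩
  cnt w 𝕓 s + cntList 𝕓 (replicate d 𝕒)   ≡⟨ cong (_+_ (cnt w 𝕓 s)) (cntList-𝕓-replicate-𝕒 d) ⟩
  cnt w 𝕓 s + 0                           ≡⟨ +-identityʳ _ ⟩
  cnt w 𝕓 s                               ∎
  where
  open ≡-Reasoning
  block : ∀ {j} → j < length (replicate d 𝕒) → w (s + j) ≡ nth (replicate d 𝕒) j
  block {j} j<len = trans (𝕒s j<d) (sym (nth-replicate d j j<d))
    where
    j<d : j < d
    j<d = subst (j <_) (length-replicate d) j<len

-- Substitutions and their fixed points

module Substitution (τ : Letter → List Letter) where

  ∣τ_∣ : Letter → ℕ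
  ∣τ x ∣ = length (τ x)

  -- imageLength w p = |τ(w 0 ⋯ w (p-1))|, where τ(w p) starts in τ(w).
  imageLength : Word → ℕ → ℕ
  imageLength w zero    = 0
  imageLength w (suc p) = imageLength w p + ∣τ w p ∣

  IsFixedPoint : Word → Set
  IsFixedPoint w = ∀ p {j} → j < ∣τ w p ∣ → w (imageLength w p + j) ≡ nth (τ (w p)) j

  iterate : ℕ → List Letter
  iterate zero    = 𝕒 ∷ []
  iterate (suc n) = concatMap τ (iterate n)

  imageLength-cong : PrefixDetermined imageLength
  imageLength-cong {p = zero}  agree = refl
  imageLength-cong {p = suc p} agree =
    cong₂ _+_ (imageLength-cong (AgreeBelow-mono (n≤1+n p) agree)) (cong ∣τ_∣ (agree ≤-refl))

  imageLength-suc : ∀ w p → imageLength w (suc p) ≡ ∣τ w 0 ∣ + imageLength (w ∘ suc) p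
  imageLength-suc w zero    = +-comm 0 _
  imageLength-suc w (suc p) = trans (cong (_+ ∣τ w (suc p) ∣) (imageLength-suc w p)) (+-assoc ∣τ w 0 ∣ _ _)

  imageLength-split : ∀ w p → imageLength w p ≡ ∣τ 𝕒 ∣ * cnt w 𝕒 p + ∣τ 𝕓 ∣ * cnt w 𝕓 p
  imageLength-split w zero    = sym (cong₂ _+_ (*-zeroʳ ∣τ 𝕒 ∣) (*-zeroʳ ∣τ 𝕓 ∣))
  imageLength-split w (suc p) = begin
    imageLength w p + ∣τ w p ∣
      ≡⟨ cong₂ _+_ (imageLength-split w p) (∣τ∣-split (w p)) ⟩
    (∣τ 𝕒 ∣ * cnt w 𝕒 p + ∣τ 𝕓 ∣ * cnt w 𝕓 p) + (∣τ 𝕒 ∣ * ind 𝕒 (w p) + ∣τ 𝕓 ∣ * ind 𝕓 (w p))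
      ≡⟨ collect ∣τ 𝕒 ∣ ∣τ 𝕓 ∣ _ _ _ _ ⟩
    ∣τ 𝕒 ∣ * cnt w 𝕒 (suc p) + ∣τ 𝕓 ∣ * cnt w 𝕓 (suc p) ∎
    where
    open ≡-Reasoning
    unit : ∀ a b → a ≡ a * 1 + b * 0
    unit = ℕ-Ring.solve-∀
    ∣τ∣-split : ∀ y → ∣τ y ∣ ≡ ∣τ 𝕒 ∣ * ind 𝕒 y + ∣τ 𝕓 ∣ * ind 𝕓 y
    ∣τ∣-split 𝕒 = unit ∣τ 𝕒 ∣ ∣τ 𝕓 ∣
    ∣τ∣-split 𝕓 = trans (unit ∣τ 𝕓 ∣ ∣τ 𝕒 ∣) (+-comm (∣τ 𝕓 ∣ * 1) (∣τ 𝕒 ∣ * 0))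
    collect : ∀ α β A B a b → (α * A + β * B) + (α * a + β * b) ≡ α * (A + a) + β * (B + b)
    collect = ℕ-Ring.solve-∀

  cnt-imageLength : IsFixedPoint w → (∀ y → cntList x (τ y) ≡ ind x′ y) →
    ∀ p → cnt w x (imageLength w p) ≡ cnt w x′ p
  cnt-imageLength {w} {x} fixed count zero    = refl
  cnt-imageLength {w} {x} fixed count (suc p) = begin
    cnt w x (imageLength w p + ∣τ w p ∣)          ≡⟨ cnt-block w x (imageLength w p) (τ (w p)) (fixed p) ⟩
    cnt w x (imageLength w p) + cntList x (τ (w p)) ≡⟨ cong₂ _+_ (cnt-imageLength fixed count p) (count (w p)) ⟩
    cnt w _ p + ind _ (w p)                        ∎
    where open ≡-Reasoning

  nth-concatMap : ∀ xs p {j} → p < length xs → j < ∣τ nth xs p ∣ →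
    nth (concatMap τ xs) (imageLength (nth xs) p + j) ≡ nth (τ (nth xs p)) j
  nth-concatMap (x ∷ xs) zero    {j} _   j<∣τx∣ = nth-++ˡ (τ x) (concatMap τ xs) j j<∣τx∣
  nth-concatMap (x ∷ xs) (suc p) {j} p<n j<∣τxp∣ = begin
    nth (τ x ++ concatMap τ xs) (imageLength (nth (x ∷ xs)) (suc p) + j)
      ≡⟨ cong (λ t → nth (τ x ++ concatMap τ xs) (t + j)) (imageLength-suc (nth (x ∷ xs)) p) ⟩
    nth (τ x ++ concatMap τ xs) (∣τ x ∣ + imageLength (nth xs) p + j)
      ≡⟨ cong (nth (τ x ++ concatMap τ xs)) (+-assoc ∣τ x ∣ _ j) ⟩
    nth (τ x ++ concatMap τ xs) (∣τ x ∣ + (imageLength (nth xs) p + j))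
      ≡⟨ nth-++ʳ (τ x) (concatMap τ xs) _ ⟩
    nth (concatMap τ xs) (imageLength (nth xs) p + j)
      ≡⟨ nth-concatMap xs p (s≤s⁻¹ p<n) j<∣τxp∣ ⟩
    nth (τ (nth xs p)) j ∎
    where open ≡-Reasoning

  module NonErasing (nonErasing : ∀ x → 1 ≤ ∣τ x ∣) where

    p≤imageLength : ∀ w p → p ≤ imageLength w p
    p≤imageLength w zero    = z≤n
    p≤imageLength w (suc p) = subst (_≤ imageLength w (suc p)) (+-comm p 1) (+-mono-≤ (p≤imageLength w p) (nonErasing (w p)))

    length≤length-concatMap : ∀ xs → length xs ≤ length (concatMap τ xs)
    length≤length-concatMap []       = z≤n
    length≤length-concatMap (x ∷ xs) =
      subst (suc (length xs) ≤_) (sym (length-++ (τ x))) (+-mono-≤ (nonErasing x) (length≤length-concatMap xs))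

  module Prolongable (t : List Letter) (τ𝕒≡𝕒∷t : τ 𝕒 ≡ 𝕒 ∷ t) (t≢[] : 1 ≤ length t)
                     (nonErasing : ∀ x → 1 ≤ ∣τ x ∣) where
    open NonErasing nonErasing

    τ[𝕒∷_] : ∀ rest → concatMap τ (𝕒 ∷ rest) ≡ 𝕒 ∷ (t ++ concatMap τ rest)
    τ[𝕒∷ rest ] = cong (_++ concatMap τ rest) τ𝕒≡𝕒∷t

    iterate-head : ∀ n → ∃[ rest ] iterate n ≡ 𝕒 ∷ rest
    iterate-head zero    = [] , refl
    iterate-head (suc n) with iterate-head n
    ... | rest , eq = t ++ concatMap τ rest , trans (cong (concatMap τ) eq) τ[𝕒∷ rest ]

    iterate-extends : ∀ n → ∃[ zs ] iterate (suc n) ≡ iterate n ++ zs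
    iterate-extends zero    = t ++ [] , τ[𝕒∷ [] ]
    iterate-extends (suc n) with iterate-extends n
    ... | zs , eq = concatMap τ zs , trans (cong (concatMap τ) eq) (concatMap-++ τ (iterate n) zs)

    length-iterate : ∀ n → n < length (iterate n)
    length-iterate zero    = s≤s z≤n
    length-iterate (suc n) with iterate-head n
    ... | rest , eq = begin-strict
      suc n                                       ≤⟨ length-iterate n ⟩
      length (iterate n)                          ≡⟨ cong length eq ⟩
      suc (length rest)                           <⟨ s≤s (+-mono-≤ t≢[] (length≤length-concatMap rest)) ⟩
      suc (length t + length (concatMap τ rest))  ≡⟨ cong suc (sym (length-++ t)) ⟩
      length (𝕒 ∷ (t ++ concatMap τ rest))        ≡⟨ cong length (sym (trans (cong (concatMap τ) eq) τ[𝕒∷ rest ])) ⟩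
      length (iterate (suc n))                    ∎
      where open ≤-Reasoning

    nth-iterate-suc : ∀ n → i < length (iterate n) → nth (iterate (suc n)) i ≡ nth (iterate n) i
    nth-iterate-suc {i} n i<len with iterate-extends n
    ... | zs , eq = trans (cong (λ xs → nth xs i) eq) (nth-++ˡ (iterate n) zs i i<len)

    nth-iterate-stable : ∀ N → i < N → nth (iterate N) i ≡ nth (iterate (suc i)) i
    nth-iterate-stable (suc N) i<1+N with m≤n⇒m<n∨m≡n (s≤s⁻¹ i<1+N)
    ... | inj₂ refl = refl
    ... | inj₁ i<N  = trans (nth-iterate-suc N (<-trans i<N (length-iterate N))) (nth-iterate-stable N i<N)

    limit-isFixedPoint : (∀ i → w i ≡ nth (iterate (suc i)) i) → IsFixedPoint w
    limit-isFixedPoint {w} limit p {j} j<∣τwp∣ = begin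
      w (imageLength w p + j)                              ≡⟨ w≡iterate (suc (suc pos)) (<-trans (n<1+n pos) (n<1+n (suc pos))) ⟩
      nth (concatMap τ xs) (imageLength w p + j)           ≡⟨ cong (λ r → nth (concatMap τ xs) (r + j)) (imageLength-cong agree) ⟩
      nth (concatMap τ xs) (imageLength (nth xs) p + j)    ≡⟨ nth-concatMap xs p p<len (subst (λ y → j < ∣τ y ∣) wp≡ j<∣τwp∣) ⟩
      nth (τ (nth xs p)) j                                 ≡⟨ cong (λ y → nth (τ y) j) (sym wp≡) ⟩
      nth (τ (w p)) j                                      ∎
      where
      open ≡-Reasoning
      pos : ℕ
      pos = imageLength w p + j
      xs : List Letter
      xs = iterate (suc pos)
      w≡iterate : ∀ N {q} → q < N → w q ≡ nth (iterate N) q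
      w≡iterate N {q} q<N = trans (limit q) (sym (nth-iterate-stable N q<N))
      p<1+pos : p < suc pos
      p<1+pos = s≤s (≤-trans (p≤imageLength w p) (m≤m+n _ j))
      agree : AgreeBelow p w (nth xs)
      agree q<p = w≡iterate (suc pos) (<-trans q<p p<1+pos)
      wp≡ : w p ≡ nth xs p
      wp≡ = w≡iterate (suc pos) p<1+pos
      p<len : p < length xs
      p<len = <-trans p<1+pos (length-iterate (suc pos))

-- The substitution σ k l m

iter≡iterate : ∀ k l m n → iter k l m n ≡ Substitution.iterate (σ k l m) n
iter≡iterate k l m zero    = refl
iter≡iterate k l m (suc n) = cong (concatMap (σ k l m)) (iter≡iterate k l m n)

length-σ𝕒 : ∀ k l m → length (σ k l m 𝕒) ≡ k + suc l
length-σ𝕒 k l m = trans (length-++ (replicate k 𝕒)) (cong₂ _+_ (length-replicate k) (cong suc (length-replicate l)))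

length-σ𝕓 : ∀ k l m → length (σ k l m 𝕓) ≡ m
length-σ𝕓 k l m = length-replicate m

cntList-𝕓-σ : ∀ k l m y → cntList 𝕓 (σ k l m y) ≡ ind 𝕒 y
cntList-𝕓-σ k l m 𝕒 = trans (cntList-++ 𝕓 (replicate k 𝕒) (𝕓 ∷ replicate l 𝕒))
  (cong₂ _+_ (cntList-𝕓-replicate-𝕒 k) (cong suc (cntList-𝕓-replicate-𝕒 l)))
cntList-𝕓-σ k l m 𝕓 = cntList-𝕓-replicate-𝕒 m

-- Where σ(w p) has its 𝕓 inside σ(w), provided w p = 𝕒.
σ-bPosition : ℕ → ℕ → ℕ → Word → ℕ → ℕ
σ-bPosition k l m w p = Substitution.imageLength (σ k l m) w p + k

σ-bPosition≡rhsB : ∀ k l m → suc (cnt w 𝕒 pa) ≡ n → + σ-bPosition k l m w pa ≡ rhsB k l m pa n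
σ-bPosition≡rhsB {w} {pa} {n} k l m #pa = begin
  + (imageLength w pa + k)
    ≡⟨ cong (λ r → + (r + k)) (imageLength-split w pa) ⟩
  + (∣τ 𝕒 ∣ * A + ∣τ 𝕓 ∣ * B + k)
    ≡⟨ cong₂ (λ α β → + (α * A + β * B + k)) (length-σ𝕒 k l m) (length-σ𝕓 k l m) ⟩
  + ((k + suc l) * A + m * B + k)
    ≡⟨ cong₂ (λ a b → a ℤ.+ b ℤ.+ + k) (ℤP.pos-* (k + suc l) A) (ℤP.pos-* m B) ⟩
  (+ k ℤ.+ (+ 1 ℤ.+ + l)) ℤ.* + A ℤ.+ + m ℤ.* + B ℤ.+ + k
    ≡⟨ identity (+ k) (+ l) (+ m) (+ A) (+ B) ⟩
  rhsB k l m (A + B) (suc A)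
    ≡⟨ cong₂ (rhsB k l m) (cnt𝕒+cnt𝕓 w pa) #pa ⟩
  rhsB k l m pa n ∎
  where
  open ≡-Reasoning
  open Substitution (σ k l m)
  A B : ℕ
  A = cnt w 𝕒 pa
  B = cnt w 𝕓 pa
  identity : ∀ K L M A B →
    (K ℤ.+ (+ 1 ℤ.+ L)) ℤ.* A ℤ.+ M ℤ.* B ℤ.+ K
      ≡ M ℤ.* (A ℤ.+ B) ℤ.+ ((K ℤ.+ L ℤ.+ + 1) ℤ.- M) ℤ.* (+ 1 ℤ.+ A) ℤ.+ M ℤ.- L ℤ.- + 1
  identity = ℤ-Ring.solve-∀

rhsR≡rhsB-p : ∀ k l m p n → rhsR k l m p n ≡ rhsB k l m p n ℤ.- + p
rhsR≡rhsB-p k l m p n = shift (+ p) (+ n) (+ (k + l + 1)) (+ m) (+ l)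
  where
  shift : ∀ P N KL M L →
    (M ℤ.- + 1) ℤ.* P ℤ.+ (KL ℤ.- M) ℤ.* N ℤ.+ M ℤ.- L ℤ.- + 1
      ≡ (M ℤ.* P ℤ.+ (KL ℤ.- M) ℤ.* N ℤ.+ M ℤ.- L ℤ.- + 1) ℤ.- P
  shift = ℤ-Ring.solve-∀

RelativePositionLaw : ℕ → ℕ → ℕ → Word → Set
RelativePositionLaw k l m w = ∀ n pa pb → 1 ≤ n → NthOcc w 𝕒 n pa → NthOcc w 𝕓 n pb →
  (+ pb) ℤ.- (+ pa) ≡ rhsR k l m pa n

RelativePositionLaw⇒BPositionLaw : ∀ k l m → RelativePositionLaw k l m w → BPositionLaw (σ-bPosition k l m) w
RelativePositionLaw⇒BPositionLaw {w} k l m law n pa pb a-occ@(_ , #pa) b-occ =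
  ℤP.+-injective (∙-cancelʳ (ℤ.- + pa) (+ pb) _ (begin
    + pb ℤ.- + pa                          ≡⟨ law n pa pb (subst (1 ≤_) #pa (s≤s z≤n)) a-occ b-occ ⟩
    rhsR k l m pa n                        ≡⟨ rhsR≡rhsB-p k l m pa n ⟩
    rhsB k l m pa n ℤ.- + pa               ≡⟨ cong (ℤ._- + pa) (sym (σ-bPosition≡rhsB k l m #pa)) ⟩
    + σ-bPosition k l m w pa ℤ.- + pa      ∎))
  where open ≡-Reasoning

module _ (k′ l m′ : ℕ) where
  private
    k m : ℕ
    k = suc k′
    m = suc m′

  open Substitution (σ k l m)

  σ-nonErasing : ∀ x → 1 ≤ ∣τ x ∣
  σ-nonErasing 𝕒 = s≤s z≤n
  σ-nonErasing 𝕓 = s≤s z≤n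

  open NonErasing σ-nonErasing

  k<∣σ𝕒∣ : k < ∣τ 𝕒 ∣
  k<∣σ𝕒∣ = subst (k <_) (sym (length-σ𝕒 k l m)) (m<m+n k (s≤s z≤n))

  fixpt-isFixedPoint : IsFixedPoint (fixpt k l m)
  fixpt-isFixedPoint = limit-isFixedPoint (λ i → cong (λ xs → nth xs i) (iter≡iterate k l m (suc i)))
    where
    σ𝕒-tail : List Letter
    σ𝕒-tail = replicate k′ 𝕒 ++ 𝕓 ∷ replicate l 𝕒
    σ𝕒-tail-nonempty : 1 ≤ length σ𝕒-tail
    σ𝕒-tail-nonempty = subst (1 ≤_) (sym (length-++ (replicate k′ 𝕒))) (≤-trans (s≤s z≤n) (m≤n+m _ (length (replicate k′ 𝕒))))
    open Prolongable σ𝕒-tail refl σ𝕒-tail-nonempty σ-nonErasing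

  module _ {w} (fixed : IsFixedPoint w) where

    𝕒-at-imageLength : ∀ p → w (imageLength w p) ≡ 𝕒
    𝕒-at-imageLength p = trans (cong w (sym (+-identityʳ _))) (trans (fixed p (σ-nonErasing (w p))) (σ-head (w p)))
      where
      σ-head : ∀ y → nth (σ k l m y) 0 ≡ 𝕒
      σ-head 𝕒 = refl
      σ-head 𝕓 = refl

    σ𝕒-at-imageLength : w p ≡ 𝕒 → j < ∣τ 𝕒 ∣ → w (imageLength w p + j) ≡ nth (σ k l m 𝕒) j
    σ𝕒-at-imageLength {p} {j} wp≡𝕒 j<∣σ𝕒∣ =
      trans (fixed p (subst (λ y → j < ∣τ y ∣) (sym wp≡𝕒) j<∣σ𝕒∣)) (cong (λ y → nth (σ k l m y) j) wp≡𝕒)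

    𝕒-in-σ𝕒 : w p ≡ 𝕒 → j < k → w (imageLength w p + j) ≡ 𝕒
    𝕒-in-σ𝕒 {p} {j} wp≡𝕒 j<k = begin
      w (imageLength w p + j)                    ≡⟨ σ𝕒-at-imageLength wp≡𝕒 (<-trans j<k k<∣σ𝕒∣) ⟩
      nth (replicate k 𝕒 ++ 𝕓 ∷ replicate l 𝕒) j ≡⟨ nth-++ˡ (replicate k 𝕒) _ j (subst (j <_) (sym (length-replicate k)) j<k) ⟩
      nth (replicate k 𝕒) j                      ≡⟨ nth-replicate k j j<k ⟩
      𝕒                                          ∎
      where open ≡-Reasoning

    𝕓-in-σ𝕒 : w p ≡ 𝕒 → w (σ-bPosition k l m w p) ≡ 𝕓
    𝕓-in-σ𝕒 wp≡𝕒 = trans (σ𝕒-at-imageLength wp≡𝕒 k<∣σ𝕒∣) (nth-replicate-++ k (𝕓 ∷ replicate l 𝕒))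

    fixedPoint-In𝒲 : In𝒲 w
    fixedPoint-In𝒲 = (λ N → imageLength w N , p≤imageLength w N , 𝕒-at-imageLength N)
                   , (λ N → σ-bPosition k l m w (imageLength w N)
                          , ≤-trans (p≤imageLength w N) (≤-trans (p≤imageLength w _) (m≤m+n _ k))
                          , 𝕓-in-σ𝕒 (𝕒-at-imageLength N))

    fixedPoint-BPositionLaw : BPositionLaw (σ-bPosition k l m) w
    fixedPoint-BPositionLaw n pa pb a-occ@(wpa≡𝕒 , #pa) b-occ =
      NthOcc-functional b-occ (𝕓-in-σ𝕒 wpa≡𝕒 , trans (cong suc #b≡#a) #pa)
      where
      #b≡#a : cnt w 𝕓 (σ-bPosition k l m w pa) ≡ cnt w 𝕒 pa
      #b≡#a = trans (cnt𝕓-𝕒-block w (imageLength w pa) k (𝕒-in-σ𝕒 wpa≡𝕒))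
                    (cnt-imageLength fixed (cntList-𝕓-σ k l m) pa)

  σ-bPosition-prefixDetermined : PrefixDetermined (σ-bPosition k l m)
  σ-bPosition-prefixDetermined agree = cong (_+ k) (imageLength-cong agree)

  σ-bPosition-ahead : ∀ w p → p < σ-bPosition k l m w p
  σ-bPosition-ahead w p = ≤-<-trans (p≤imageLength w p) (m<m+n _ (s≤s z≤n))

  fixpt-In𝒲 : In𝒲 (fixpt k l m)
  fixpt-In𝒲 = fixedPoint-In𝒲 fixpt-isFixedPoint

  fixpt-BPositionLaw : BPositionLaw (σ-bPosition k l m) (fixpt k l m)
  fixpt-BPositionLaw = fixedPoint-BPositionLaw fixpt-isFixedPoint

  fixpt-bPosition : ∀ n pa pb → 1 ≤ n → NthOcc (fixpt k l m) 𝕒 n pa → NthOcc (fixpt k l m) 𝕓 n pb →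
    + pb ≡ rhsB k l m pa n
  fixpt-bPosition n pa pb _ a-occ b-occ =
    trans (cong +_ (fixpt-BPositionLaw n pa pb a-occ b-occ))
          (σ-bPosition≡rhsB {w = fixpt k l m} {pa = pa} k l m (proj₂ a-occ))

  fixpt-relativePosition : RelativePositionLaw k l m (fixpt k l m)
  fixpt-relativePosition n pa pb 1≤n a-occ b-occ =
    trans (cong (ℤ._- + pa) (fixpt-bPosition n pa pb 1≤n a-occ b-occ)) (sym (rhsR≡rhsB-p k l m pa n))

  fixpt-unique : In𝒲 w′ → RelativePositionLaw k l m w′ → ∀ i → w′ i ≡ fixpt k l m i
  fixpt-unique w′∈𝒲 law =
    BPositionLaw-unique σ-bPosition-prefixDetermined σ-bPosition-ahead fixpt-In𝒲 w′∈𝒲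
      fixpt-BPositionLaw (RelativePositionLaw⇒BPositionLaw k l m law)

theorem4p20 : (k l m : ℕ) → 1 ≤ k → 1 ≤ m →
    In𝒲 (fixpt k l m)
    × ((n pa pb : ℕ) → 1 ≤ n → NthOcc (fixpt k l m) 𝕒 n pa → NthOcc (fixpt k l m) 𝕓 n pb →
         (+ pb) ≡ rhsB k l m pa n)
    × ((n pa pb : ℕ) → 1 ≤ n → NthOcc (fixpt k l m) 𝕒 n pa → NthOcc (fixpt k l m) 𝕓 n pb →
         (+ pb) ℤ.- (+ pa) ≡ rhsR k l m pa n)
    × ((w′ : Word) → In𝒲 w′ →
         ((n pa pb : ℕ) → 1 ≤ n → NthOcc w′ 𝕒 n pa → NthOcc w′ 𝕓 n pb →
           (+ pb) ℤ.- (+ pa) ≡ rhsR k l m pa n) →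
         (i : ℕ) → w′ i ≡ fixpt k l m i)
theorem4p20 zero     l m        () _
theorem4p20 (suc k′) l zero     _  ()
theorem4p20 (suc k′) l (suc m′) _  _ =
    fixpt-In𝒲 k′ l m′
  , fixpt-bPosition k′ l m′
  , fixpt-relativePosition k′ l m′
  , λ w′ → fixpt-unique k′ l m′
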